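{- Let $n\ge1$ and $\tau\in S_n$. Then $\{\beta_\tau(k):k\in K(\tau)\}$ equals the set of all $\sigma^{ -1}$, $\sigma\in S_n$, such that $$\sigma_{i-1}\le\sigma_i+w_{\sigma_i}(\tau)\quad\text{for all }i\in\{1,\dots,n\},$$ with the convention $\sigma_0=n+1$.
   Context: For $\tau\in S_n$ (one-line notation): runs $R_1,\dots,R_k$ are the maximal blocks of consecutive positions on which $\tau$ is increasing; add $R_{k+1}=\{n+1\}$ with $\tau_{n+1}:=0$. For $i\in R_j$ ($1\le i\le n$), $r_i(\tau)=\{i'\in R_j:\tau_{i'}>\tau_i\}\cup\{i'\in R_{j+1}:\tau_{i'}<\tau_i\}\subset\{i+1,\dots,n+1\}$ and $w_i(\tau)=|r_i(\tau)|$. $K(\tau)=\{k\in\mathbb Z_{\ge0}^n:k_i\le w_i(\tau)-1\ \forall i\}$. For $k\in K(\tau)$, $\beta_\tau(k)$ is constructed as follows: start with the word $(n+1)$; for $i=n,n-1,\dots,1$, list the elements of $r_i(\tau)$ (all already in the word) in the order they occur in the current word read from right to left, and insert the letter $i$ immediately to the right of the $k_i$-th of them (counting from $0$). The final word is $(n+1,\sigma_1,\dots,\sigma_n)$ with $\sigma\in S_n$, and $\beta_\tau(k)=\sigma^{ -1}$. -}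

module Defs where

open import Data.Nat using (ℕ; zero; suc; _+_; _∸_; _≤_; _<_; _<ᵇ_; _≡ᵇ_)
open import Data.Nat.Properties using (_≟_)
open import Data.Bool using (Bool; true; false; if_then_else_; _∧_; _∨_)
open import Data.Fin using (Fin; toℕ)
open import Data.Fin.Permutation using (Permutation′; _⟨$⟩ʳ_; _⟨$⟩ˡ_)
open import Data.List using (List; []; _∷_; map; filter; length; reverse; upTo; allFin)
open import Data.Bool.ListAction using (any)
open import Data.Vec using (Vec; toList)
open import Data.Maybe using (Maybe; just; nothing)
open import Relation.Binary.PropositionalEquality using (_≡_)

-- Convention: all positions and values are natural numbers 1..n (as in the paper),
-- a permutation π : Permutation′ n is read in one-line notation as
-- π_i = 1 + toℕ (π ⟨$⟩ʳ (i-1)).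

-- 0-based list lookup with default 0
nth : List ℕ → ℕ → ℕ
nth []       _       = 0
nth (x ∷ xs) zero    = x
nth (x ∷ xs) (suc j) = nth xs j

-- 1-based position of a value in a list (0 if absent)
posOf : ℕ → List ℕ → ℕ
posOf a []       = 0
posOf a (x ∷ xs) = if a ≡ᵇ x then 1 else (if posOf a xs ≡ᵇ 0 then 0 else suc (posOf a xs))

oneLine : ∀ {n} → Permutation′ n → List ℕ
oneLine π = map (λ i → suc (toℕ (π ⟨$⟩ʳ i))) (allFin _)

-- τ_i for 1 ≤ i ≤ n, and τ_{n+1} = 0
tval : ∀ {n} → Permutation′ n → ℕ → ℕ
tval τ zero    = 0
tval τ (suc i) = nth (oneLine τ) i

pos : ℕ → List ℕ
pos m = map suc (upTo m)

-- For 1 ≤ i ≤ n+1 this is (index of the run containing i) - 1,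
-- runs being the maximal increasing blocks R_1,…,R_k and R_{k+1} = {n+1}.
runIdx : ∀ {n} → Permutation′ n → ℕ → ℕ
runIdx τ i = length (filter (λ j → tval τ (suc j) <? tval τ j) (pos (i ∸ 1)))
  where
  open import Data.Nat using (_<?_)

rset : ∀ {n} → Permutation′ n → ℕ → List ℕ
rset {n} τ i = filter (λ i' → inR i') (pos (suc n))
  where
  open import Relation.Nullary.Decidable using (Dec; yes; no)
  open import Data.Sum using (_⊎_)
  open import Data.Product using (_×_)
  open import Relation.Nullary.Decidable using (_⊎-dec_; _×-dec_)
  open import Data.Nat using (_<?_)
  inR : (i' : ℕ) → Dec (((runIdx τ i' ≡ runIdx τ i) × (tval τ i < tval τ i'))
                      ⊎ ((runIdx τ i' ≡ suc (runIdx τ i)) × (tval τ i' < tval τ i)))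
  inR i' = ((runIdx τ i' ≟ runIdx τ i) ×-dec (tval τ i <? tval τ i'))
           ⊎-dec ((runIdx τ i' ≟ suc (runIdx τ i)) ×-dec (tval τ i' <? tval τ i))

w : ∀ {n} → Permutation′ n → ℕ → ℕ
w τ i = length (rset τ i)

memb : List ℕ → ℕ → Bool
memb xs y = any (λ x → x ≡ᵇ y) xs

-- On the word read from right to left (i.e. the reversed word): insert a immediately
-- before the k-th (counting from 0) letter satisfying p; this is "immediately to the
-- right" of it in the original word.  (Fallback at the end if there is no such letter;
-- never used for k ∈ K(τ).)
insertRev : (ℕ → Bool) → ℕ → ℕ → List ℕ → List ℕ
insertRev p k a [] = a ∷ []
insertRev p k a (x ∷ xs) with p x | k
... | true  | zero   = a ∷ x ∷ xs
... | true  | suc k' = x ∷ insertRev p k' a xs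
... | false | _      = x ∷ insertRev p k a xs

kAt : ∀ {n} → Vec ℕ n → ℕ → ℕ
kAt k i = nth (toList k) (i ∸ 1)

step : ∀ {n} → Permutation′ n → Vec ℕ n → ℕ → List ℕ → List ℕ
step τ k i word = reverse (insertRev (memb (rset τ i)) (kAt k i) i (reverse word))

steps : ∀ {n} → Permutation′ n → Vec ℕ n → ℕ → List ℕ → List ℕ
steps τ k zero    word = word
steps τ k (suc m) word = steps τ k m (step τ k (suc m) word)

-- the final word (n+1, σ_1, …, σ_n)
finalWord : ∀ {n} → Permutation′ n → Vec ℕ n → List ℕ
finalWord {n} τ k = steps τ k n (suc n ∷ [])

tailL : List ℕ → List ℕ
tailL []       = []
tailL (_ ∷ xs) = xs

-- β_τ(k) = σ⁻¹ in one-line notation: β_j = position of j in (σ_1,…,σ_n)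
beta : ∀ {n} → Permutation′ n → Vec ℕ n → List ℕ
beta {n} τ k = map (λ j → posOf j (tailL (finalWord τ k))) (pos n)

Represents : ∀ {n} → List ℕ → (Fin n → Fin n) → Set
Represents {n} l f = (length l ≡ n) × (∀ (j : Fin n) → nth l (toℕ j) ≡ suc (toℕ (f j)))
  where open import Data.Product using (_×_)

-- K(τ) = { k ∈ ℕ^n : k_i ≤ w_i(τ) - 1 } (read over ℤ, i.e. k_i < w_i(τ))
InK : ∀ {n} → Permutation′ n → Vec ℕ n → Set
InK {n} τ k = ∀ (i : Fin n) → kAt k (suc (toℕ i)) < w τ (suc (toℕ i))

-- σ_{i-1} for the position i = 1 + toℕ j, with σ_0 = n+1
prevVal : ∀ {n} → Permutation′ n → ℕ → ℕ
prevVal {n} σ zero    = suc n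
prevVal {n} σ (suc j) = tval σ (suc j)

Cond : ∀ {n} → Permutation′ n → Permutation′ n → Set
Cond {n} τ σ = ∀ (j : Fin n) →
  prevVal σ (toℕ j) ≤ suc (toℕ (σ ⟨$⟩ʳ j)) + w τ (suc (toℕ (σ ⟨$⟩ʳ j)))

module Submission where

-- Put M i = i + w_i(τ).  The combinatorial core is that r_i(τ) is the interval
-- {i+1, …, M i}: its elements exceed i, and it is closed downwards above i,
-- because τ increases inside each run; moreover M is weakly increasing on 1..n.
-- Read the word (n+1, σ_1, …, σ_n) from right to left: the condition on σ says
-- that each letter b is followed by a letter a ≤ M b ("linked" words).
--
-- Forward direction: inserting i directly before the k_i-th letter of r_i with
-- k_i < w_i keeps the reversed word linked, keeps n+1 as its last letter and
-- adds the letter i; so the final word is (n+1, σ) for a permutation σ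
-- satisfying the condition, and β_τ(k) = σ⁻¹.
-- Backward direction: for such σ let stage m be the letters > m of the
-- reversed final word, in order.  In stage m the letter j = m+1 is followed by
-- the first later letter exceeding j; by linkedness and monotonicity of M that
-- letter is ≤ M j, hence lies in r_j.  So inserting j into stage j at k_j, the
-- number of r_j-letters before j, gives stage m, and k_j < w_j.

open import Defs
open import Data.Nat using (ℕ; _≤_)
open import Data.Vec using (Vec)
open import Data.Product using (Σ; _×_)
open import Data.Fin.Permutation using (Permutation′; _⟨$⟩ˡ_)

open import Data.Nat using (zero; suc; _+_; _∸_; _<_; z≤n; s≤s; _<ᵇ_; _≡ᵇ_; _<?_)
open import Data.Nat.Properties
open import Data.Bool using (Bool; true; false; _∧_; _∨_; if_then_else_)
open import Data.Bool.Properties using (T-≡; ∧-identityʳ; ∧-zeroʳ; ∨-zeroʳ)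
open import Data.Empty using (⊥; ⊥-elim)
open import Data.Sum using (_⊎_; inj₁; inj₂)
open import Data.Product using (_,_; proj₁; proj₂)
open import Data.List
  using (List; []; _∷_; _++_; [_]; reverse; reverseAcc; length; map; filter; filterᵇ; tabulate; applyUpTo; allFin)
import Data.List.Properties as ListP
open import Data.List.Relation.Unary.All using (All; []; _∷_)
open import Data.List.Relation.Unary.Linked using (Linked; []; [-]; _∷_) renaming (tail to linked-tail)
open import Data.Fin as F using (Fin; toℕ; fromℕ<)
import Data.Fin.Properties as FinP
open import Data.Fin.Permutation using (_⟨$⟩ʳ_; inverseˡ; inverseʳ; permutation)
import Data.Vec as Vec
open import Function using (flip; _∘_)
open import Function.Bundles using (Equivalence)
open import Relation.Binary.PropositionalEquality hiding ([_])
open import Relation.Nullary using (¬_; Dec; yes; no; does)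
open import Relation.Nullary.Decidable using (_⊎-dec_; _×-dec_; T?)
open import Relation.Unary using (Pred; Decidable)
open import Algebra.Properties.CommutativeSemigroup +-commutativeSemigroup using (x∙yz≈y∙xz)
open import Algebra.Properties.CommutativeMonoid.Sum +-0-commutativeMonoid using (sum; sum-permute)

≡ᵇ-true⇒≡ : ∀ m n → (m ≡ᵇ n) ≡ true → m ≡ n
≡ᵇ-true⇒≡ m n e = ≡ᵇ⇒≡ m n (Equivalence.from T-≡ e)

≡ᵇ-refl : ∀ n → (n ≡ᵇ n) ≡ true
≡ᵇ-refl n = Equivalence.to T-≡ (≡⇒≡ᵇ n n refl)

≢⇒≡ᵇ-false : ∀ {m n} → m ≢ n → (m ≡ᵇ n) ≡ false
≢⇒≡ᵇ-false {m} {n} m≢n with m ≡ᵇ n in e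
... | true  = ⊥-elim (m≢n (≡ᵇ-true⇒≡ m n e))
... | false = refl

<ᵇ-true⇒< : ∀ m n → (m <ᵇ n) ≡ true → m < n
<ᵇ-true⇒< m n e = <ᵇ⇒< m n (Equivalence.from T-≡ e)

<⇒<ᵇ-true : ∀ {m n} → m < n → (m <ᵇ n) ≡ true
<⇒<ᵇ-true m<n = Equivalence.to T-≡ (<⇒<ᵇ m<n)

≮⇒<ᵇ-false : ∀ {m n} → ¬ m < n → (m <ᵇ n) ≡ false
≮⇒<ᵇ-false {m} {n} m≮n with m <ᵇ n in e
... | true  = ⊥-elim (m≮n (<ᵇ-true⇒< m n e))
... | false = refl

<ᵇ-false⇒≮ : ∀ m n → (m <ᵇ n) ≡ false → ¬ m < n
<ᵇ-false⇒≮ m n e m<n with trans (sym (<⇒<ᵇ-true m<n)) e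
... | ()

<ᵇ-shift : ∀ {m x} → x ≢ suc m → (m <ᵇ x) ≡ (suc m <ᵇ x)
<ᵇ-shift {m} {x} x≢m+1 with m <? x
... | yes m<x = trans (<⇒<ᵇ-true m<x) (sym (<⇒<ᵇ-true (≤∧≢⇒< m<x (λ e → x≢m+1 (sym e)))))
... | no m≮x  = trans (≮⇒<ᵇ-false m≮x) (sym (≮⇒<ᵇ-false (λ m+1<x → m≮x (≤-trans (n≤1+n (suc m)) m+1<x))))

indicator : Bool → ℕ
indicator true  = 1
indicator false = 0

count : (ℕ → Bool) → List ℕ → ℕ
count p []       = 0
count p (x ∷ xs) = indicator (p x) + count p xs

count-++ : ∀ p xs ys → count p (xs ++ ys) ≡ count p xs + count p ys
count-++ p []       ys = refl
count-++ p (x ∷ xs) ys =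
  trans (cong (indicator (p x) +_) (count-++ p xs ys)) (sym (+-assoc (indicator (p x)) _ _))

count-reverse : ∀ p xs → count p (reverse xs) ≡ count p xs
count-reverse p []       = refl
count-reverse p (x ∷ xs) = begin
    count p (reverse (x ∷ xs))           ≡⟨ cong (count p) (ListP.unfold-reverse x xs) ⟩
    count p (reverse xs ++ [ x ])        ≡⟨ count-++ p (reverse xs) [ x ] ⟩
    count p (reverse xs) + count p [ x ] ≡⟨ cong₂ _+_ (count-reverse p xs) (+-identityʳ _) ⟩
    count p xs + indicator (p x)         ≡⟨ +-comm (count p xs) _ ⟩
    count p (x ∷ xs)                     ∎
  where open ≡-Reasoning

count≤length : ∀ p xs → count p xs ≤ length xs
count≤length p []       = z≤n
count≤length p (x ∷ xs) with p x
... | true  = s≤s (count≤length p xs)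
... | false = m≤n⇒m≤1+n (count≤length p xs)

count-all : ∀ xs → count (λ _ → true) xs ≡ length xs
count-all []       = refl
count-all (x ∷ xs) = cong suc (count-all xs)

count-cong : ∀ {p q} xs → (∀ x → p x ≡ q x) → count p xs ≡ count q xs
count-cong []       e = refl
count-cong (x ∷ xs) e = cong₂ _+_ (cong indicator (e x)) (count-cong xs e)

count-cong-on : ∀ {p q} xs → (∀ x → memb xs x ≡ true → p x ≡ q x) → count p xs ≡ count q xs
count-cong-on []       h = refl
count-cong-on (y ∷ xs) h =
  cong₂ _+_ (cong indicator (h y (cong (_∨ memb xs y) (≡ᵇ-refl y))))
            (count-cong-on xs (λ x m → h x (trans (cong ((y ≡ᵇ x) ∨_) m) (∨-zeroʳ (y ≡ᵇ x)))))

memb-filter⁻ : ∀ {ℓ} {P : Pred ℕ ℓ} (P? : Decidable P) xs x →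
  memb (filter P? xs) x ≡ true → P x × memb xs x ≡ true
memb-filter⁻ P? []       x ()
memb-filter⁻ P? (y ∷ xs) x h with P? y
memb-filter⁻ P? (y ∷ xs) x h | yes py with y ≡ᵇ x in e
... | true  = subst _ (≡ᵇ-true⇒≡ y x e) py , refl
... | false = memb-filter⁻ P? xs x h
memb-filter⁻ P? (y ∷ xs) x h | no _ with memb-filter⁻ P? xs x h
... | px , m rewrite m = px , ∨-zeroʳ (y ≡ᵇ x)

memb-filter⁺ : ∀ {ℓ} {P : Pred ℕ ℓ} (P? : Decidable P) xs x →
  memb xs x ≡ true → P x → memb (filter P? xs) x ≡ true
memb-filter⁺ P? []       x () px
memb-filter⁺ P? (y ∷ xs) x m px with P? y
... | yes _ with y ≡ᵇ x
...   | true  = refl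
...   | false = memb-filter⁺ P? xs x m px
memb-filter⁺ P? (y ∷ xs) x m px | no ¬py with y ≡ᵇ x in e
... | true  = ⊥-elim (¬py (subst _ (sym (≡ᵇ-true⇒≡ y x e)) px))
... | false = memb-filter⁺ P? xs x m px

length-filter : ∀ {ℓ} {P : Pred ℕ ℓ} (P? : Decidable P) xs →
  length (filter P? xs) ≡ count (memb (filter P? xs)) xs
length-filter P? xs = trans (count-does xs) (count-cong-on xs agree)
  where
  count-does : ∀ ys → length (filter P? ys) ≡ count (λ x → does (P? x)) ys
  count-does []       = refl
  count-does (y ∷ ys) with P? y
  ... | yes _ = cong suc (count-does ys)
  ... | no _  = count-does ys
  agree : ∀ x → memb xs x ≡ true → does (P? x) ≡ memb (filter P? xs) x
  agree x m with P? x
  ... | yes px = sym (memb-filter⁺ P? xs x m px)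
  ... | no ¬px with memb (filter P? xs) x in e
  ...   | true  = ⊥-elim (¬px (proj₁ (memb-filter⁻ P? xs x e)))
  ...   | false = refl

Occurs : ℕ → List ℕ → Set
Occurs x xs = 1 ≤ count (x ≡ᵇ_) xs

occurs-head : ∀ x xs → Occurs x (x ∷ xs)
occurs-head x xs = subst (λ b → 1 ≤ indicator b + count (x ≡ᵇ_) xs) (sym (≡ᵇ-refl x)) (s≤s z≤n)

occurs-tail : ∀ x y xs → Occurs x xs → Occurs x (y ∷ xs)
occurs-tail x y xs o = ≤-trans o (m≤n+m _ (indicator (x ≡ᵇ y)))

occurs-++ʳ : ∀ {x} xs ys → Occurs x ys → Occurs x (xs ++ ys)
occurs-++ʳ {x} xs ys o rewrite count-++ (x ≡ᵇ_) xs ys = ≤-trans o (m≤n+m _ _)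

occurs-absent : ∀ {j x xs} → count (j ≡ᵇ_) xs ≡ 0 → Occurs x xs → x ≢ j
occurs-absent z o refl = <-irrefl refl (≤-trans o (≤-reflexive z))

all-occurs : ∀ {ℓ} {P : Pred ℕ ℓ} xs → (∀ y → Occurs y xs → P y) → All P xs
all-occurs []       h = []
all-occurs (x ∷ xs) h = h x (occurs-head x xs) ∷ all-occurs xs (λ y o → h y (occurs-tail y x xs o))

nth-occurs : ∀ xs i → i < length xs → Occurs (nth xs i) xs
nth-occurs (x ∷ xs) zero    _        = occurs-head x xs
nth-occurs (x ∷ xs) (suc i) (s≤s lt) = occurs-tail (nth xs i) x xs (nth-occurs xs i lt)

range : ℕ → ℕ → List ℕ
range a zero    = []
range a (suc c) = a ∷ range (suc a) c

range-snoc : ∀ a c → range a (suc c) ≡ range a c ++ [ a + c ]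
range-snoc a zero    = cong [_] (sym (+-identityʳ a))
range-snoc a (suc c) =
  cong (a ∷_) (trans (range-snoc (suc a) c) (cong (λ z → range (suc a) c ++ [ z ]) (sym (+-suc a c))))

range-++ : ∀ a b c → range a (b + c) ≡ range a b ++ range (a + b) c
range-++ a zero    c = cong (λ z → range z c) (sym (+-identityʳ a))
range-++ a (suc b) c =
  cong (a ∷_) (trans (range-++ (suc a) b c) (cong (λ z → range (suc a) b ++ range z c) (sym (+-suc a b))))

length-range : ∀ a c → length (range a c) ≡ c
length-range a zero    = refl
length-range a (suc c) = cong suc (length-range (suc a) c)

nth-range : ∀ a c i → i < c → nth (range a c) i ≡ a + i
nth-range a (suc c) zero    _        = sym (+-identityʳ a)
nth-range a (suc c) (suc i) (s≤s lt) = trans (nth-range (suc a) c i lt) (sym (+-suc a i))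

range-empty : ∀ {a x} → a ≤ x → x < a + 0 → ⊥
range-empty {a} a≤x x<a = <-irrefl refl (≤-trans x<a (≤-trans (≤-reflexive (+-identityʳ a)) a≤x))

pos≡range : ∀ m → pos m ≡ range 1 m
pos≡range m = go 0 m (λ i → i) (λ i → refl)
  where
  go : ∀ a c (f : ℕ → ℕ) → (∀ i → f i ≡ a + i) → map suc (applyUpTo f c) ≡ range (suc a) c
  go a zero    f e = refl
  go a (suc c) f e = cong₂ _∷_ (cong suc (trans (e 0) (+-identityʳ a)))
    (go (suc a) c (λ i → f (suc i)) (λ i → trans (e (suc i)) (+-suc a i)))

pos-snoc : ∀ m → pos (suc m) ≡ pos m ++ [ suc m ]
pos-snoc m = trans (pos≡range (suc m)) (trans (range-snoc 1 m) (cong (_++ [ suc m ]) (sym (pos≡range m))))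

count-range-none : ∀ p a c → (∀ y → a ≤ y → y < a + c → p y ≡ false) → count p (range a c) ≡ 0
count-range-none p a zero    h = refl
count-range-none p a (suc c) h rewrite h a ≤-refl (m<m+n a (s≤s z≤n)) =
  count-range-none p (suc a) c (λ y a<y y<ac → h y (≤-trans (n≤1+n a) a<y) (subst (y <_) (sym (+-suc a c)) y<ac))

count-range-single : ∀ x a c → a ≤ x → x < a + c → count (x ≡ᵇ_) (range a c) ≡ 1
count-range-single x a zero    a≤x x<ac = ⊥-elim (range-empty a≤x x<ac)
count-range-single x a (suc c) a≤x x<ac with x ≟ a
... | yes refl rewrite ≡ᵇ-refl x =
  cong suc (count-range-none (x ≡ᵇ_) (suc x) c (λ y x<y _ → ≢⇒≡ᵇ-false (λ e → <-irrefl e x<y)))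
... | no x≢a rewrite ≢⇒≡ᵇ-false x≢a =
  count-range-single x (suc a) c (≤∧≢⇒< a≤x (λ e → x≢a (sym e))) (subst (x <_) (+-suc a c) x<ac)

memb-range⁻ : ∀ a c x → memb (range a c) x ≡ true → a ≤ x × x < a + c
memb-range⁻ a zero    x ()
memb-range⁻ a (suc c) x h with a ≡ᵇ x in e
... | true rewrite ≡ᵇ-true⇒≡ a x e = ≤-refl , m<m+n x (s≤s z≤n)
... | false with memb-range⁻ (suc a) c x h
...   | a<x , x<ac = ≤-trans (n≤1+n a) a<x , subst (x <_) (sym (+-suc a c)) x<ac

memb-range⁺ : ∀ a c x → a ≤ x → x < a + c → memb (range a c) x ≡ true
memb-range⁺ a zero    x a≤x x<ac = ⊥-elim (range-empty a≤x x<ac)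
memb-range⁺ a (suc c) x a≤x x<ac with a ≟ x
... | yes refl rewrite ≡ᵇ-refl a = refl
... | no a≢x rewrite ≢⇒≡ᵇ-false a≢x =
  memb-range⁺ (suc a) c x (≤∧≢⇒< a≤x a≢x) (subst (x <_) (+-suc a c) x<ac)

occurs-range : ∀ x a c → Occurs x (range a c) → a ≤ x × x < a + c
occurs-range x a c o with a ≤? x | x <? a + c
... | yes a≤x | yes x<ac = a≤x , x<ac
... | no a≰x  | _ = ⊥-elim (<-irrefl refl (≤-trans o (≤-reflexive (count-range-none (x ≡ᵇ_) a c
        (λ y a≤y _ → ≢⇒≡ᵇ-false (λ e → a≰x (subst (a ≤_) (sym e) a≤y)))))))
... | yes _   | no x≮ac = ⊥-elim (<-irrefl refl (≤-trans o (≤-reflexive (count-range-none (x ≡ᵇ_) a c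
        (λ y _ y<ac → ≢⇒≡ᵇ-false (λ e → x≮ac (subst (_< a + c) (sym e) y<ac)))))))

count-range-≤1 : ∀ x a c → count (x ≡ᵇ_) (range a c) ≤ 1
count-range-≤1 x a c with count (x ≡ᵇ_) (range a c) in e
... | zero  = z≤n
... | suc _ with occurs-range x a c (subst (1 ≤_) (sym e) (s≤s z≤n))
...   | a≤x , x<ac = ≤-reflexive (trans (sym e) (count-range-single x a c a≤x x<ac))

DownClosedAbove : (ℕ → Bool) → ℕ → Set
DownClosedAbove p a = ∀ x → a ≤ x → p (suc x) ≡ true → p x ≡ true

downClosed-false : ∀ p a → DownClosedAbove p a → p a ≡ false → ∀ x → a ≤ x → p x ≡ false
downClosed-false p a dc pa x a≤x = subst (λ z → p z ≡ false) (m+[n∸m]≡n a≤x) (go (x ∸ a))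
  where
  go : ∀ d → p (a + d) ≡ false
  go zero    rewrite +-identityʳ a = pa
  go (suc d) with p (a + suc d) in e
  ... | false = refl
  ... | true with trans (sym (dc (a + d) (m≤m+n a d) (trans (cong p (sym (+-suc a d))) e))) (go d)
  ...   | ()

downClosed-prefix : ∀ p a c → DownClosedAbove p a → ∀ x → a ≤ x → x < a + c →
  (p x ≡ true → x < a + count p (range a c)) × (x < a + count p (range a c) → p x ≡ true)
downClosed-prefix p a zero    dc x a≤x x<ac = ⊥-elim (range-empty a≤x x<ac)
downClosed-prefix p a (suc c) dc x a≤x x<ac with p a in pa
... | false = (λ px → ⊥-elim (px≢true px)) , (λ x<bound → ⊥-elim (<⇒≱ x<bound a+none≤x))
  where
  px≢true : p x ≢ true
  px≢true px with trans (sym px) (downClosed-false p a dc pa x a≤x)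
  ... | ()
  a+none≤x : a + count p (range (suc a) c) ≤ x
  a+none≤x = subst (_≤ x) (sym (trans (cong (a +_) (count-range-none p (suc a) c
    (λ y a<y _ → downClosed-false p a dc pa y (≤-trans (n≤1+n a) a<y)))) (+-identityʳ a))) a≤x
... | true with a ≟ x
...   | yes refl = (λ _ → m<m+n a (s≤s z≤n)) , (λ _ → pa)
...   | no a≢x with downClosed-prefix p (suc a) c (λ y a<y → dc y (≤-trans (n≤1+n a) a<y))
                   x (≤∧≢⇒< a≤x a≢x) (subst (x <_) (+-suc a c) x<ac)
...     | sound , complete = (λ px → subst (x <_) (sym (+-suc a _)) (sound px))
                           , (λ lt → complete (subst (x <_) (+-suc a _) lt))

record _≋_ (xs ys : List ℕ) : Set where
  constructor counts-agree
  field counts : ∀ p → count p xs ≡ count p ys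
open _≋_ public

≋-length : ∀ {xs ys} → xs ≋ ys → length xs ≡ length ys
≋-length {xs} {ys} eq = trans (sym (count-all xs)) (trans (counts eq (λ _ → true)) (count-all ys))

≋-range-occurs : ∀ {x xs a c} → xs ≋ range a c → Occurs x xs → a ≤ x × x < a + c
≋-range-occurs {x} {xs} {a} {c} eq o = occurs-range x a c (subst (1 ≤_) (counts eq (x ≡ᵇ_)) o)

≋-range-unique : ∀ {x xs a c} → xs ≋ range a c → count (x ≡ᵇ_) xs ≤ 1
≋-range-unique {x} {xs} {a} {c} eq = subst (_≤ 1) (sym (counts eq (x ≡ᵇ_))) (count-range-≤1 x a c)

≋-range-member : ∀ {x xs a c} → xs ≋ range a c → a ≤ x → x < a + c → Occurs x xs
≋-range-member {x} {xs} {a} {c} eq a≤x x<ac =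
  subst (1 ≤_) (sym (counts eq (x ≡ᵇ_))) (≤-reflexive (sym (count-range-single x a c a≤x x<ac)))

≋-cancel-last : ∀ xs ys z → (xs ++ [ z ]) ≋ (ys ++ [ z ]) → xs ≋ ys
≋-cancel-last xs ys z eq = counts-agree λ p → +-cancelʳ-≡ (count p [ z ]) _ _
  (trans (sym (count-++ p xs [ z ])) (trans (counts eq p) (count-++ p ys [ z ])))

posOf-occurs : ∀ x xs → Occurs x xs → Σ ℕ (λ i → posOf x xs ≡ suc i × i < length xs × nth xs i ≡ x)
posOf-occurs x []       ()
posOf-occurs x (y ∷ xs) o with x ≡ᵇ y in e
... | true  = 0 , refl , s≤s z≤n , sym (≡ᵇ-true⇒≡ x y e)
... | false with posOf-occurs x xs o
...   | i , p , lt , q rewrite p = suc i , refl , s≤s lt , q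

posOf-nth : ∀ xs i → count (nth xs i ≡ᵇ_) xs ≤ 1 → i < length xs → posOf (nth xs i) xs ≡ suc i
posOf-nth (y ∷ xs) zero    u lt rewrite ≡ᵇ-refl y = refl
posOf-nth (y ∷ xs) (suc i) u (s≤s lt) with nth xs i ≡ᵇ y in e
... | true  = ⊥-elim (<-irrefl refl (≤-trans (s≤s (nth-occurs xs i lt)) u))
... | false rewrite posOf-nth xs i u lt = refl

before : ℕ → List ℕ → List ℕ
before j []       = []
before j (x ∷ xs) = if j ≡ᵇ x then [] else x ∷ before j xs

after : ℕ → List ℕ → List ℕ
after j []       = []
after j (x ∷ xs) = if j ≡ᵇ x then xs else after j xs

split-at : ∀ j xs → Occurs j xs → (xs ≡ before j xs ++ j ∷ after j xs) × count (j ≡ᵇ_) (before j xs) ≡ 0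
split-at j []       ()
split-at j (x ∷ xs) o with j ≡ᵇ x in e
... | true  = cong (_∷ xs) (sym (≡ᵇ-true⇒≡ j x e)) , refl
... | false with split-at j xs o
...   | split , absent = cong (x ∷_) split , trans (cong (λ b → indicator b + count (j ≡ᵇ_) (before j xs)) e) absent

split-last : ∀ xs j ys zs z → xs ++ j ∷ ys ≡ zs ++ [ z ] → j ≢ z → Σ (List ℕ) (λ ys′ → ys ≡ ys′ ++ [ z ])
split-last []       j ys []       z refl j≢z = ⊥-elim (j≢z refl)
split-last []       j ys (y ∷ zs) z refl _   = zs , refl
split-last (x ∷ []) j ys []       z e    _ with ListP.∷-injectiveʳ e
... | ()
split-last (x ∷ _ ∷ _) j ys [] z e _ with ListP.∷-injectiveʳ e
... | ()
split-last (x ∷ xs) j ys (y ∷ zs) z e j≢z = split-last xs j ys zs z (ListP.∷-injectiveʳ e) j≢z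

count-filterᵇ : ∀ p q xs → count p (filterᵇ q xs) ≡ count (λ x → p x ∧ q x) xs
count-filterᵇ p q []       = refl
count-filterᵇ p q (x ∷ xs) with q x
... | true  rewrite ∧-identityʳ (p x) = cong (indicator (p x) +_) (count-filterᵇ p q xs)
... | false rewrite ∧-zeroʳ (p x) = count-filterᵇ p q xs

filterᵇ-cong-on : ∀ q q′ xs → (∀ x → Occurs x xs → q x ≡ q′ x) → filterᵇ q xs ≡ filterᵇ q′ xs
filterᵇ-cong-on q q′ []       h = refl
filterᵇ-cong-on q q′ (x ∷ xs) h rewrite h x (occurs-head x xs) with q′ x
... | true  = cong (x ∷_) (filterᵇ-cong-on q q′ xs (λ y o → h y (occurs-tail y x xs o)))
... | false = filterᵇ-cong-on q q′ xs (λ y o → h y (occurs-tail y x xs o))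

filterᵇ-all : ∀ q xs → (∀ x → Occurs x xs → q x ≡ true) → filterᵇ q xs ≡ xs
filterᵇ-all q []       h = refl
filterᵇ-all q (x ∷ xs) h rewrite h x (occurs-head x xs) =
  cong (x ∷_) (filterᵇ-all q xs (λ y o → h y (occurs-tail y x xs o)))

filterᵇ-none : ∀ q xs → (∀ x → Occurs x xs → q x ≡ false) → filterᵇ q xs ≡ []
filterᵇ-none q []       h = refl
filterᵇ-none q (x ∷ xs) h rewrite h x (occurs-head x xs) =
  filterᵇ-none q xs (λ y o → h y (occurs-tail y x xs o))

filterᵇ-head : ∀ q xs x ys → filterᵇ q xs ≡ x ∷ ys → q x ≡ true × Occurs x xs
filterᵇ-head q []       x ys ()
filterᵇ-head q (y ∷ xs) x ys e with q y in qy
... | true with e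
...   | refl = qy , occurs-head x xs
filterᵇ-head q (y ∷ xs) x ys e | false with filterᵇ-head q xs x ys e
... | qx , o = qx , occurs-tail x y xs o

count-insert : ∀ p k a xs q → count q (insertRev p k a xs) ≡ indicator (q a) + count q xs
count-insert p k a []       q = refl
count-insert p k a (x ∷ xs) q with p x | k
... | true  | zero   = refl
... | true  | suc k′ rewrite count-insert p k′ a xs q = x∙yz≈y∙xz (indicator (q x)) (indicator (q a)) (count q xs)
... | false | k′     rewrite count-insert p k′ a xs q = x∙yz≈y∙xz (indicator (q x)) (indicator (q a)) (count q xs)

insert-keeps-last : ∀ p k a xs z → k < count p (xs ++ [ z ]) →
  Σ (List ℕ) (λ ys → insertRev p k a (xs ++ [ z ]) ≡ ys ++ [ z ])
insert-keeps-last p k a [] z lt with p z | k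
... | true  | zero   = a ∷ [] , refl
... | true  | suc _  = ⊥-elim (<⇒≱ lt (s≤s z≤n))
... | false | _      = ⊥-elim (<⇒≱ lt z≤n)
insert-keeps-last p k a (x ∷ xs) z lt with p x | k
... | true  | zero   = a ∷ x ∷ xs , refl
... | true  | suc k′ with insert-keeps-last p k′ a xs z (≤-pred lt)
...   | ys , e = x ∷ ys , cong (x ∷_) e
insert-keeps-last p k a (x ∷ xs) z lt | false | k′ with insert-keeps-last p k′ a xs z lt
...   | ys , e = x ∷ ys , cong (x ∷_) e

insert-at : ∀ p xs a x ys → p x ≡ true → insertRev p (count p xs) a (xs ++ x ∷ ys) ≡ xs ++ a ∷ x ∷ ys
insert-at p []       a x ys px rewrite px = refl
insert-at p (y ∷ xs) a x ys px with p y
... | true  = cong (y ∷_) (insert-at p xs a x ys px)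
... | false = cong (y ∷_) (insert-at p xs a x ys px)

-- Insertion preserves linkedness when the new letter relates to what may
-- precede it (everything) and to what may follow it (the hits).

linked-insert-after : ∀ {R : ℕ → ℕ → Set} p k a b xs → k < count p xs → (∀ x → p x ≡ true → R a x) →
  All (λ y → R y a) (b ∷ xs) → Linked R (b ∷ xs) → Linked R (b ∷ insertRev p k a xs)
linked-insert-after p k a b []       () _ _ _
linked-insert-after p k a b (x ∷ xs) lt ha (rb ∷ hb) (rbx ∷ l) with p x in px | k
... | true  | zero   = rb ∷ ha x px ∷ l
... | true  | suc k′ = rbx ∷ linked-insert-after p k′ a x xs (≤-pred lt) ha hb l
... | false | k′     = rbx ∷ linked-insert-after p k′ a x xs lt ha hb l

linked-insert : ∀ {R : ℕ → ℕ → Set} p k a xs → k < count p xs → (∀ x → p x ≡ true → R a x) →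
  All (λ y → R y a) xs → Linked R xs → Linked R (insertRev p k a xs)
linked-insert p k a []       () _ _ _
linked-insert p k a (x ∷ xs) lt ha hb l with p x in px | k
... | true  | zero   = ha x px ∷ l
... | true  | suc k′ = linked-insert-after p k′ a x xs (≤-pred lt) ha hb l
... | false | k′     = linked-insert-after p k′ a x xs lt ha hb l

linked-reverseAcc : ∀ {R : ℕ → ℕ → Set} x xs acc → Linked R (x ∷ xs) → Linked (flip R) (x ∷ acc) →
  Linked (flip R) (reverseAcc (x ∷ acc) xs)
linked-reverseAcc x []       acc _          l = l
linked-reverseAcc x (y ∷ xs) acc (rxy ∷ lx) l = linked-reverseAcc y xs (x ∷ acc) lx (rxy ∷ l)

linked-reverse : ∀ {R : ℕ → ℕ → Set} xs → Linked R xs → Linked (flip R) (reverse xs)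
linked-reverse []       _ = []
linked-reverse (x ∷ xs) l = linked-reverseAcc x xs [] l [-]

linked-suffix : ∀ {R : ℕ → ℕ → Set} xs ys → Linked R (xs ++ ys) → Linked R ys
linked-suffix []       ys l = l
linked-suffix (x ∷ xs) ys l = linked-suffix xs ys (linked-tail l)

linked⇒adjacent : ∀ {R : ℕ → ℕ → Set} xs → Linked R xs → ∀ i → suc i < length xs → R (nth xs i) (nth xs (suc i))
linked⇒adjacent []           _       i       ()
linked⇒adjacent (x ∷ [])     _       i       (s≤s ())
linked⇒adjacent (x ∷ y ∷ xs) (r ∷ l) zero    _  = r
linked⇒adjacent (x ∷ y ∷ xs) (r ∷ l) (suc i) lt = linked⇒adjacent (y ∷ xs) l i (≤-pred lt)

adjacent⇒linked : ∀ {R : ℕ → ℕ → Set} xs → (∀ i → suc i < length xs → R (nth xs i) (nth xs (suc i))) → Linked R xs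
adjacent⇒linked []           h = []
adjacent⇒linked (x ∷ [])     h = [-]
adjacent⇒linked (x ∷ y ∷ xs) h = h 0 (s≤s (s≤s z≤n)) ∷ adjacent⇒linked (y ∷ xs) (λ i lt → h (suc i) (s≤s lt))

stepsRev : ∀ {n} → Permutation′ n → Vec ℕ n → ℕ → List ℕ → List ℕ
stepsRev τ k zero    R = R
stepsRev τ k (suc m) R = stepsRev τ k m (insertRev (memb (rset τ (suc m))) (kAt k (suc m)) (suc m) R)

steps≡stepsRev : ∀ {n} (τ : Permutation′ n) k m W → steps τ k m W ≡ reverse (stepsRev τ k m (reverse W))
steps≡stepsRev τ k zero    W = sym (ListP.reverse-involutive W)
steps≡stepsRev τ k (suc m) W
  rewrite steps≡stepsRev τ k m (step τ k (suc m) W)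
        | ListP.reverse-involutive (insertRev (memb (rset τ (suc m))) (kAt k (suc m)) (suc m) (reverse W)) = refl

nth-tabulate : ∀ {m} {B : Set} (h : B → ℕ) (g : Fin m → B) (f : Fin m) → nth (map h (tabulate g)) (toℕ f) ≡ h (g f)
nth-tabulate h g F.zero    = refl
nth-tabulate h g (F.suc f) = nth-tabulate h (λ i → g (F.suc i)) f

nth-oneLine : ∀ {n} (π : Permutation′ n) (f : Fin n) → nth (oneLine π) (toℕ f) ≡ suc (toℕ (π ⟨$⟩ʳ f))
nth-oneLine π f = nth-tabulate (λ i → suc (toℕ (π ⟨$⟩ʳ i))) (λ i → i) f

length-oneLine : ∀ {n} (π : Permutation′ n) → length (oneLine π) ≡ n
length-oneLine {n} π = trans (ListP.length-map _ (allFin n)) (ListP.length-tabulate (λ i → i))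

nth-beyond : ∀ xs i → length xs ≤ i → nth xs i ≡ 0
nth-beyond []       i       _        = refl
nth-beyond (x ∷ xs) (suc i) (s≤s le) = nth-beyond xs i le

toℕ-onto : ∀ {n} i → i < n → Σ (Fin n) (λ f → toℕ f ≡ i)
toℕ-onto i i<n = fromℕ< i<n , FinP.toℕ-fromℕ< i<n

tabulate-nth : ∀ m xs → length xs ≡ m → tabulate {n = m} (λ i → nth xs (toℕ i)) ≡ xs
tabulate-nth zero    []       _ = refl
tabulate-nth (suc m) (x ∷ xs) e = cong (x ∷_) (tabulate-nth m xs (suc-injective e))

tabulate-range : ∀ m a → tabulate {n = m} (λ i → a + toℕ i) ≡ range a m
tabulate-range zero    a = refl
tabulate-range (suc m) a = cong₂ _∷_ (+-identityʳ a)
  (trans (ListP.tabulate-cong (λ i → +-suc a (toℕ i))) (tabulate-range m (suc a)))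

nth-vecTabulate : ∀ {m} (h : Fin m → ℕ) (f : Fin m) → nth (Vec.toList (Vec.tabulate h)) (toℕ f) ≡ h f
nth-vecTabulate h F.zero    = refl
nth-vecTabulate h (F.suc f) = nth-vecTabulate (λ i → h (F.suc i)) f

nth-map : ∀ (h : ℕ → ℕ) xs i → i < length xs → nth (map h xs) i ≡ h (nth xs i)
nth-map h (x ∷ xs) zero    _        = refl
nth-map h (x ∷ xs) (suc i) (s≤s lt) = nth-map h xs i lt

count-tabulate : ∀ {m} p (g : Fin m → ℕ) → count p (tabulate g) ≡ sum (λ i → indicator (p (g i)))
count-tabulate {zero}  p g = refl
count-tabulate {suc m} p g = cong (indicator (p (g F.zero)) +_) (count-tabulate p (λ i → g (F.suc i)))

oneLine-≋ : ∀ {n} (π : Permutation′ n) → oneLine π ≋ range 1 n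
oneLine-≋ {n} π = counts-agree λ p → begin
    count p (oneLine π)                                ≡⟨ cong (count p) (ListP.map-tabulate (λ i → i) (λ i → suc (toℕ (π ⟨$⟩ʳ i)))) ⟩
    count p (tabulate (λ i → suc (toℕ (π ⟨$⟩ʳ i))))   ≡⟨ count-tabulate p (λ i → suc (toℕ (π ⟨$⟩ʳ i))) ⟩
    sum {n} (λ i → indicator (p (suc (toℕ (π ⟨$⟩ʳ i))))) ≡⟨ sym (sum-permute {n} {n} (λ i → indicator (p (suc (toℕ i)))) π) ⟩
    sum {n} (λ i → indicator (p (suc (toℕ i))))        ≡⟨ sym (count-tabulate {n} p (λ i → suc (toℕ i))) ⟩
    count p (tabulate {n = n} (λ i → suc (toℕ i)))      ≡⟨ cong (count p) (tabulate-range n 1) ⟩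
    count p (range 1 n)                                 ∎
  where open ≡-Reasoning

word⇒permutation : ∀ {n} s → s ≋ range 1 n →
  Σ (Permutation′ n) (λ σ → oneLine σ ≡ s × (∀ j → nth s (toℕ (σ ⟨$⟩ˡ j)) ≡ suc (toℕ j)))
word⇒permutation {n} s letters = permutation value position value∘position position∘value , oneLine≡ , hits
  where
  len : length s ≡ n
  len = trans (≋-length letters) (length-range 1 n)
  in-s : ∀ (i : Fin n) → toℕ i < length s
  in-s i = subst (toℕ i <_) (sym len) (FinP.toℕ<n i)
  bounds : ∀ i → 1 ≤ nth s (toℕ i) × nth s (toℕ i) < 1 + n
  bounds i = ≋-range-occurs letters (nth-occurs s (toℕ i) (in-s i))
  pred-bound : ∀ {v} → 1 ≤ v × v < 1 + n → v ∸ 1 < n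
  pred-bound {suc v} (_ , s≤s v<n) = v<n
  suc[v∸1]≡v : ∀ {v} → 1 ≤ v → suc (v ∸ 1) ≡ v
  suc[v∸1]≡v {suc v} _ = refl
  value : Fin n → Fin n
  value i = fromℕ< (pred-bound (bounds i))
  value-spec : ∀ i → suc (toℕ (value i)) ≡ nth s (toℕ i)
  value-spec i = trans (cong suc (FinP.toℕ-fromℕ< (pred-bound (bounds i)))) (suc[v∸1]≡v (proj₁ (bounds i)))
  located : ∀ (j : Fin n) → Σ ℕ (λ i → posOf (suc (toℕ j)) s ≡ suc i × i < length s × nth s i ≡ suc (toℕ j))
  located j = posOf-occurs (suc (toℕ j)) s (≋-range-member letters (s≤s z≤n) (s≤s (FinP.toℕ<n j)))
  position : Fin n → Fin n
  position j = fromℕ< (subst (proj₁ (located j) <_) len (proj₁ (proj₂ (proj₂ (located j)))))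
  position-spec : ∀ j → toℕ (position j) ≡ proj₁ (located j)
  position-spec j = FinP.toℕ-fromℕ< (subst (proj₁ (located j) <_) len (proj₁ (proj₂ (proj₂ (located j)))))
  hits : ∀ j → nth s (toℕ (position j)) ≡ suc (toℕ j)
  hits j = trans (cong (nth s) (position-spec j)) (proj₂ (proj₂ (proj₂ (located j))))
  value∘position : ∀ j → value (position j) ≡ j
  value∘position j = FinP.toℕ-injective (suc-injective (trans (value-spec (position j)) (hits j)))
  position∘value : ∀ i → position (value i) ≡ i
  position∘value i = FinP.toℕ-injective (suc-injective (begin
      suc (toℕ (position (value i)))      ≡⟨ cong suc (position-spec (value i)) ⟩
      suc (proj₁ (located (value i)))     ≡⟨ sym (proj₁ (proj₂ (located (value i)))) ⟩
      posOf (suc (toℕ (value i))) s       ≡⟨ cong (λ z → posOf z s) (value-spec i) ⟩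
      posOf (nth s (toℕ i)) s             ≡⟨ posOf-nth s (toℕ i) (≋-range-unique {x = nth s (toℕ i)} letters) (in-s i) ⟩
      suc (toℕ i)                         ∎))
    where open ≡-Reasoning
  oneLine≡ : oneLine (permutation value position value∘position position∘value) ≡ s
  oneLine≡ = trans (ListP.map-tabulate (λ i → i) (λ i → suc (toℕ (value i))))
                   (trans (ListP.tabulate-cong value-spec) (tabulate-nth n s len))

positions-represent : ∀ {n} s → s ≋ range 1 n → (h : Fin n → Fin n) → (∀ j → nth s (toℕ (h j)) ≡ suc (toℕ j)) →
  Represents (map (λ j → posOf j s) (pos n)) h
positions-represent {n} s letters h hits = trans (ListP.length-map _ (pos n)) length-pos , entry
  where
  length-pos : length (pos n) ≡ n
  length-pos = trans (cong length (pos≡range n)) (length-range 1 n)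
  entry : ∀ j → nth (map (λ j → posOf j s) (pos n)) (toℕ j) ≡ suc (toℕ (h j))
  entry j = begin
      nth (map (λ j → posOf j s) (pos n)) (toℕ j) ≡⟨ nth-map (λ j → posOf j s) (pos n) (toℕ j) (subst (toℕ j <_) (sym length-pos) (FinP.toℕ<n j)) ⟩
      posOf (nth (pos n) (toℕ j)) s               ≡⟨ cong (λ z → posOf (nth z (toℕ j)) s) (pos≡range n) ⟩
      posOf (nth (range 1 n) (toℕ j)) s           ≡⟨ cong (λ z → posOf z s) (nth-range 1 n (toℕ j) (FinP.toℕ<n j)) ⟩
      posOf (suc (toℕ j)) s                       ≡⟨ cong (λ z → posOf z s) (sym (hits j)) ⟩
      posOf (nth s (toℕ (h j))) s                 ≡⟨ posOf-nth s (toℕ (h j)) (≋-range-unique {x = nth s (toℕ (h j))} letters)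
                                                       (subst (toℕ (h j) <_) (sym (trans (≋-length letters) (length-range 1 n))) (FinP.toℕ<n (h j))) ⟩
      suc (toℕ (h j))                             ∎
    where open ≡-Reasoning

beta-represents : ∀ {n} (τ : Permutation′ n) k s → finalWord τ k ≡ suc n ∷ s → s ≋ range 1 n →
  (h : Fin n → Fin n) → (∀ j → nth s (toℕ (h j)) ≡ suc (toℕ j)) → Represents (beta τ k) h
beta-represents {n} τ k s final letters h hits =
  subst (λ W → Represents (map (λ j → posOf j (tailL W)) (pos n)) h) (sym final) (positions-represent s letters h hits)

-- Runs of τ.  Positions i and i′ with i < i′ lie in the same run exactly when
-- no descent occurs between them, and then τ_i < τ_{i′}.  This yields the
-- three properties of r_i(τ) used below.
module Runs {n : ℕ} (τ : Permutation′ n) where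

  val : ℕ → ℕ
  val = tval τ

  run : ℕ → ℕ
  run = runIdx τ

  val-last : val (suc n) ≡ 0
  val-last = nth-beyond (oneLine τ) n (≤-reflexive (length-oneLine τ))

  val-inside : ∀ i → i < n → Σ (Fin n) (λ f → toℕ f ≡ i × val (suc i) ≡ suc (toℕ (τ ⟨$⟩ʳ f)))
  val-inside i i<n with toℕ-onto i i<n
  ... | f , refl = f , refl , nth-oneLine τ f

  val-injective : ∀ x y → 1 ≤ x → x ≤ suc n → 1 ≤ y → y ≤ suc n → val x ≡ val y → x ≡ y
  val-injective (suc i) (suc j) _ (s≤s i≤n) _ (s≤s j≤n) e with m≤n⇒m<n∨m≡n i≤n | m≤n⇒m<n∨m≡n j≤n
  ... | inj₁ i<n | inj₁ j<n with val-inside i i<n | val-inside j j<n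
  ...   | f , refl , ef | g , refl , eg = cong (λ z → suc (toℕ z))
          (trans (sym (inverseˡ τ)) (trans (cong (τ ⟨$⟩ˡ_) (FinP.toℕ-injective (suc-injective (trans (sym ef) (trans e eg))))) (inverseˡ τ)))
  val-injective (suc i) (suc j) _ _ _ _ e | inj₁ i<n | inj₂ refl with val-inside i i<n
  ...   | f , refl , ef with trans (sym ef) (trans e val-last)
  ...     | ()
  val-injective (suc i) (suc j) _ _ _ _ e | inj₂ refl | inj₁ j<n with val-inside j j<n
  ...   | g , refl , eg with trans (sym eg) (trans (sym e) val-last)
  ...     | ()
  val-injective (suc i) (suc j) _ _ _ _ e | inj₂ refl | inj₂ refl = refl

  descent? : ∀ j → Dec (val (suc j) < val j)
  descent? j = val (suc j) <? val j

  run-split : ∀ m → run (suc (suc m)) ≡ length (filter descent? (pos m)) + length (filter descent? [ suc m ])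
  run-split m = trans (cong (λ z → length (filter descent? z)) (pos-snoc m))
    (trans (cong length (ListP.filter-++ descent? (pos m) [ suc m ])) (ListP.length-++ (filter descent? (pos m))))

  run-descent : ∀ m → val (suc (suc m)) < val (suc m) → run (suc (suc m)) ≡ suc (run (suc m))
  run-descent m lt = trans (run-split m)
    (trans (cong (λ z → length (filter descent? (pos m)) + length z) (ListP.filter-accept descent? lt)) (+-comm _ 1))

  run-ascent : ∀ m → ¬ val (suc (suc m)) < val (suc m) → run (suc (suc m)) ≡ run (suc m)
  run-ascent m ¬lt = trans (run-split m)
    (trans (cong (λ z → length (filter descent? (pos m)) + length z) (ListP.filter-reject descent? ¬lt)) (+-identityʳ _))

  run-step : ∀ x → run x ≤ run (suc x)
  run-step zero    = z≤n
  run-step (suc m) with descent? (suc m)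
  ... | yes lt = ≤-trans (n≤1+n _) (≤-reflexive (sym (run-descent m lt)))
  ... | no ¬lt = ≤-reflexive (sym (run-ascent m ¬lt))

  run-mono : ∀ x y → x ≤ y → run x ≤ run y
  run-mono x y x≤y = subst (λ z → run x ≤ run z) (m+[n∸m]≡n x≤y) (go (y ∸ x))
    where
    go : ∀ d → run x ≤ run (x + d)
    go zero    = ≤-reflexive (cong run (sym (+-identityʳ x)))
    go (suc d) = ≤-trans (go d) (≤-trans (run-step (x + d)) (≤-reflexive (cong run (sym (+-suc x d)))))

  ascent-in-run : ∀ y → 1 ≤ y → y ≤ n → run (suc y) ≡ run y → val y < val (suc y)
  ascent-in-run (suc m) _ y≤n e with descent? (suc m)
  ... | yes lt = ⊥-elim (1+n≢n (trans (sym (run-descent m lt)) e))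
  ... | no ¬lt = ≤∧≢⇒< (≮⇒≥ ¬lt)
    (λ q → 1+n≢n (sym (val-injective (suc m) (suc (suc m)) (s≤s z≤n) (≤-trans y≤n (n≤1+n n)) (s≤s z≤n) (s≤s y≤n) q)))

  increasing-in-run : ∀ j x → 1 ≤ j → j < x → x ≤ suc n → run x ≡ run j → val j < val x
  increasing-in-run j (suc x) 1≤j (s≤s j≤x) x≤n e with m≤n⇒m<n∨m≡n j≤x
  ... | inj₂ refl = ascent-in-run j 1≤j (≤-pred x≤n) e
  ... | inj₁ j<x  = <-trans (increasing-in-run j x 1≤j j<x (≤-trans (n≤1+n x) x≤n) same)
                            (ascent-in-run x (≤-trans 1≤j j≤x) (≤-pred x≤n) (trans e (sym same)))
    where
    same : run x ≡ run j
    same = ≤-antisym (≤-trans (run-step x) (≤-reflexive e)) (run-mono j x j≤x)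

  InR : ℕ → ℕ → Set
  InR i x = ((run x ≡ run i) × (val i < val x)) ⊎ ((run x ≡ suc (run i)) × (val x < val i))

  inR⇒> : ∀ i x → 1 ≤ i → 1 ≤ x → x ≤ suc n → i ≤ n → InR i x → i < x
  inR⇒> i x _ 1≤x x≤n+1 i≤n (inj₁ (e , lt)) with i <? x
  ... | yes i<x = i<x
  ... | no i≮x with m≤n⇒m<n∨m≡n (≮⇒≥ i≮x)
  ...   | inj₂ refl = ⊥-elim (<-irrefl refl lt)
  ...   | inj₁ x<i  = ⊥-elim (<-asym lt (increasing-in-run x i 1≤x x<i (≤-trans i≤n (n≤1+n n)) (sym e)))
  inR⇒> i x _ _ _ _ (inj₂ (e , lt)) with i <? x
  ... | yes i<x = i<x
  ... | no i≮x  = ⊥-elim (<-irrefl refl (≤-trans (≤-reflexive (sym e)) (run-mono x i (≮⇒≥ i≮x))))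

  inR-downward : ∀ i x → 1 ≤ i → i < x → suc x ≤ suc n → InR i (suc x) → InR i x
  inR-downward i x 1≤i i<x x<n+1 (inj₁ (e , _)) = inj₁ (same , increasing-in-run i x 1≤i i<x (≤-trans (n≤1+n x) x<n+1) same)
    where
    same : run x ≡ run i
    same = ≤-antisym (≤-trans (run-step x) (≤-reflexive e)) (run-mono i x (<⇒≤ i<x))
  inR-downward i x 1≤i i<x x<n+1 (inj₂ (e , lt)) with run x ≟ run i
  ... | yes same = inj₁ (same , increasing-in-run i x 1≤i i<x (≤-trans (n≤1+n x) x<n+1) same)
  ... | no differ = inj₂ (next , <-trans (ascent-in-run x (≤-trans 1≤i (<⇒≤ i<x)) (≤-pred x<n+1) (trans e (sym next))) lt)
    where
    next : run x ≡ suc (run i)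
    next = ≤-antisym (≤-trans (run-step x) (≤-reflexive e)) (≤∧≢⇒< (run-mono i x (<⇒≤ i<x)) (λ q → differ (sym q)))

  inR-shift : ∀ j y → 1 ≤ j → j < n → suc j < y → y ≤ suc n → InR j y → InR (suc j) y
  inR-shift (suc m) y _ j<n j+1<y y≤n+1 q with descent? (suc m)
  ... | yes lt with q
  ...   | inj₁ (e , _) = ⊥-elim (<-irrefl refl
          (≤-trans (≤-reflexive (sym (run-descent m lt))) (≤-trans (run-mono (suc (suc m)) y (<⇒≤ j+1<y)) (≤-reflexive e))))
  ...   | inj₂ (e , _) = inj₁ (same , increasing-in-run (suc (suc m)) y (s≤s z≤n) j+1<y y≤n+1 same)
    where
    same : run y ≡ run (suc (suc m))
    same = trans e (sym (run-descent m lt))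
  inR-shift (suc m) y _ j<n j+1<y y≤n+1 q | no ¬lt with q
  ...   | inj₁ (e , _) = inj₁ (same , increasing-in-run (suc (suc m)) y (s≤s z≤n) j+1<y y≤n+1 same)
    where
    same : run y ≡ run (suc (suc m))
    same = trans e (sym (run-ascent m ¬lt))
  ...   | inj₂ (e , lt′) = inj₂ (trans e (cong suc (sym (run-ascent m ¬lt))) ,
                                  <-trans lt′ (ascent-in-run (suc m) (s≤s z≤n) (<⇒≤ j<n) (run-ascent m ¬lt)))

module Interval {n : ℕ} (τ : Permutation′ n) where
  open Runs τ

  inr : ℕ → ℕ → Bool
  inr i = memb (rset τ i)

  M : ℕ → ℕ
  M i = i + w τ i

  inR? : ∀ i → Decidable (InR i)
  inR? i x = ((run x ≟ run i) ×-dec (val i <? val x)) ⊎-dec ((run x ≟ suc (run i)) ×-dec (val x <? val i))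

  inr-sound : ∀ i x → inr i x ≡ true → InR i x × 1 ≤ x × x ≤ suc n
  inr-sound i x h with memb-filter⁻ (inR? i) (pos (suc n)) x h
  ... | q , m with memb-range⁻ 1 (suc n) x (subst (λ z → memb z x ≡ true) (pos≡range (suc n)) m)
  ...   | 1≤x , x<n+2 = q , 1≤x , ≤-pred x<n+2

  inr-complete : ∀ i x → 1 ≤ x → x ≤ suc n → InR i x → inr i x ≡ true
  inr-complete i x 1≤x x≤n+1 q = memb-filter⁺ (inR? i) (pos (suc n)) x
    (subst (λ z → memb z x ≡ true) (sym (pos≡range (suc n))) (memb-range⁺ 1 (suc n) x 1≤x (s≤s x≤n+1))) q

  w≡count : ∀ i → w τ i ≡ count (inr i) (range 1 (suc n))
  w≡count i = trans (length-filter (inR? i) (pos (suc n))) (cong (count (inr i)) (pos≡range (suc n)))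

  inr⇒> : ∀ i x → 1 ≤ i → i ≤ n → inr i x ≡ true → i < x
  inr⇒> i x 1≤i i≤n h with inr-sound i x h
  ... | q , 1≤x , x≤n+1 = inR⇒> i x 1≤i 1≤x x≤n+1 i≤n q

  inr-downward : ∀ i → 1 ≤ i → i ≤ n → DownClosedAbove (inr i) (suc i)
  inr-downward i 1≤i i≤n x i<x h with inr-sound i (suc x) h
  ... | q , _ , x<n+1 = inr-complete i x (≤-trans 1≤i (≤-trans (n≤1+n i) i<x)) (≤-trans (n≤1+n x) x<n+1)
                          (inR-downward i x 1≤i i<x x<n+1 q)

  w≡count-above : ∀ i → 1 ≤ i → i ≤ n → w τ i ≡ count (inr i) (range (suc i) (suc n ∸ i))
  w≡count-above i 1≤i i≤n = begin
      w τ i                                                       ≡⟨ w≡count i ⟩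
      count (inr i) (range 1 (suc n))                             ≡⟨ cong (λ z → count (inr i) (range 1 z)) (sym i+[n+1∸i]) ⟩
      count (inr i) (range 1 (i + (suc n ∸ i)))                   ≡⟨ cong (count (inr i)) (range-++ 1 i (suc n ∸ i)) ⟩
      count (inr i) (range 1 i ++ range (suc i) (suc n ∸ i))      ≡⟨ count-++ (inr i) (range 1 i) _ ⟩
      count (inr i) (range 1 i) + count (inr i) (range (suc i) (suc n ∸ i))
                                                                  ≡⟨ cong (_+ count (inr i) (range (suc i) (suc n ∸ i))) (count-range-none (inr i) 1 i none) ⟩
      count (inr i) (range (suc i) (suc n ∸ i))                   ∎
    where
    open ≡-Reasoning
    i+[n+1∸i] : i + (suc n ∸ i) ≡ suc n
    i+[n+1∸i] = m+[n∸m]≡n (≤-trans i≤n (n≤1+n n))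
    none : ∀ y → 1 ≤ y → y < 1 + i → inr i y ≡ false
    none y _ y<1+i with inr i y in e
    ... | true  = ⊥-elim (<⇒≱ (inr⇒> i y 1≤i i≤n e) (≤-pred y<1+i))
    ... | false = refl

  -- r_i = {i+1, …, M i}: a down-closed set above i with w_i elements
  r-interval : ∀ i x → 1 ≤ i → i ≤ n → i < x → x ≤ suc n → (inr i x ≡ true → x ≤ M i) × (x ≤ M i → inr i x ≡ true)
  r-interval i x 1≤i i≤n i<x x≤n+1 =
      (λ h → ≤-pred (subst (x <_) hits (proj₁ prefix h)))
    , (λ x≤M → proj₂ prefix (subst (x <_) (sym hits) (s≤s x≤M)))
    where
    x<end : x < suc i + (suc n ∸ i)
    x<end = subst (x <_) (sym (cong suc (m+[n∸m]≡n (≤-trans i≤n (n≤1+n n))))) (s≤s x≤n+1)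
    prefix : (inr i x ≡ true → x < suc i + count (inr i) (range (suc i) (suc n ∸ i)))
           × (x < suc i + count (inr i) (range (suc i) (suc n ∸ i)) → inr i x ≡ true)
    prefix = downClosed-prefix (inr i) (suc i) (suc n ∸ i) (inr-downward i 1≤i i≤n) x i<x x<end
    hits : suc i + count (inr i) (range (suc i) (suc n ∸ i)) ≡ suc (M i)
    hits = cong (suc i +_) (sym (w≡count-above i 1≤i i≤n))

  inr⇒≤M : ∀ i x → 1 ≤ i → i ≤ n → inr i x ≡ true → x ≤ M i
  inr⇒≤M i x 1≤i i≤n h =
    proj₁ (r-interval i x 1≤i i≤n (inr⇒> i x 1≤i i≤n h) (proj₂ (proj₂ (inr-sound i x h)))) h

  ≤M⇒inr : ∀ i x → 1 ≤ i → i ≤ n → i < x → x ≤ M i → x ≤ suc n → inr i x ≡ true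
  ≤M⇒inr i x 1≤i i≤n i<x x≤M x≤n+1 = proj₂ (r-interval i x 1≤i i≤n i<x x≤n+1) x≤M

  M≤n+1 : ∀ i → 1 ≤ i → i ≤ n → M i ≤ suc n
  M≤n+1 i 1≤i i≤n = ≤-trans (+-monoʳ-≤ i w≤) (≤-reflexive (m+[n∸m]≡n (≤-trans i≤n (n≤1+n n))))
    where
    w≤ : w τ i ≤ suc n ∸ i
    w≤ = ≤-trans (≤-reflexive (w≡count-above i 1≤i i≤n))
           (≤-trans (count≤length (inr i) (range (suc i) (suc n ∸ i))) (≤-reflexive (length-range (suc i) (suc n ∸ i))))

  -- M j ≤ M (j+1): if w_j > 0 then M j ∈ r_j, and M j = j+1 or M j ∈ r_{j+1}
  M-step : ∀ j → 1 ≤ j → j < n → M j ≤ M (suc j)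
  M-step j 1≤j j<n with w τ j in w≡
  ... | zero  = ≤-trans (≤-reflexive (+-identityʳ j)) (≤-trans (n≤1+n j) (m≤m+n (suc j) _))
  ... | suc _ with M j ≟ suc j
  ...   | yes Mj≡ = ≤-trans (≤-reflexive (trans (cong (j +_) (sym w≡)) Mj≡)) (m≤m+n (suc j) _)
  ...   | no Mj≢  = ≤-trans (≤-reflexive (cong (j +_) (sym w≡))) (inr⇒≤M (suc j) (M j) (s≤s z≤n) j<n Mj∈r[j+1])
    where
    j<Mj : j < M j
    j<Mj = subst (j <_) (cong (j +_) (sym w≡)) (m<m+n j (s≤s z≤n))
    Mj≤n+1 : M j ≤ suc n
    Mj≤n+1 = M≤n+1 j 1≤j (<⇒≤ j<n)
    Mj∈r[j] : InR j (M j)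
    Mj∈r[j] = proj₁ (inr-sound j (M j) (≤M⇒inr j (M j) 1≤j (<⇒≤ j<n) j<Mj ≤-refl Mj≤n+1))
    Mj∈r[j+1] : inr (suc j) (M j) ≡ true
    Mj∈r[j+1] = inr-complete (suc j) (M j) (≤-trans 1≤j (<⇒≤ j<Mj)) Mj≤n+1
                  (inR-shift j (M j) 1≤j j<n (≤∧≢⇒< j<Mj (λ e → Mj≢ (sym e))) Mj≤n+1 Mj∈r[j])

  M-mono : ∀ b j → 1 ≤ b → b ≤ j → j ≤ n → M b ≤ M j
  M-mono b zero    1≤b b≤0 _ with ≤-trans 1≤b b≤0
  ... | ()
  M-mono b (suc j) 1≤b b≤j+1 j<n with m≤n⇒m<n∨m≡n b≤j+1
  ... | inj₂ refl = ≤-refl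
  ... | inj₁ b<j+1 = ≤-trans (M-mono b j 1≤b (≤-pred b<j+1) (≤-trans (n≤1+n j) j<n))
                             (M-step j (≤-trans 1≤b (≤-pred b<j+1)) j<n)

  -- the letter a may stand immediately left of the letter b
  Adm : ℕ → ℕ → Set
  Adm a b = a ≤ M b

  nth-word : ∀ (σ : Permutation′ n) i → nth (suc n ∷ oneLine σ) i ≡ prevVal σ i
  nth-word σ zero    = refl
  nth-word σ (suc i) = refl

  linked⇒cond : ∀ σ → Linked Adm (suc n ∷ oneLine σ) → Cond τ σ
  linked⇒cond σ l j = subst₂ Adm (nth-word σ (toℕ j)) (nth-oneLine σ j)
    (linked⇒adjacent (suc n ∷ oneLine σ) l (toℕ j) (s≤s (subst (toℕ j <_) (sym (length-oneLine σ)) (FinP.toℕ<n j))))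

  cond⇒linked : ∀ σ → Cond τ σ → Linked Adm (suc n ∷ oneLine σ)
  cond⇒linked σ cond = adjacent⇒linked (suc n ∷ oneLine σ) adjacent
    where
    adjacent : ∀ i → suc i < length (suc n ∷ oneLine σ) → Adm (nth (suc n ∷ oneLine σ) i) (nth (suc n ∷ oneLine σ) (suc i))
    adjacent i lt with toℕ-onto i (subst (i <_) (length-oneLine σ) (≤-pred lt))
    ... | f , refl = subst₂ Adm (sym (nth-word σ (toℕ f))) (sym (nth-oneLine σ f)) (cond f)

  count-inr-above : ∀ j → 1 ≤ j → j ≤ n → ∀ xs → count (inr j) (filterᵇ (j <ᵇ_) xs) ≡ count (inr j) xs
  count-inr-above j 1≤j j≤n xs = trans (count-filterᵇ (inr j) (j <ᵇ_) xs) (count-cong xs both)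
    where
    both : ∀ y → (inr j y ∧ (j <ᵇ y)) ≡ inr j y
    both y with inr j y in e
    ... | true  = <⇒<ᵇ-true (inr⇒> j y 1≤j j≤n e)
    ... | false = refl

  -- In a (flip Adm)-linked list b ∷ T with 1 ≤ b ≤ j ≤ n and positive entries,
  -- the first entry of T exceeding j is at most M j: its predecessor b′ ≤ j
  -- gives it the bound M b′ ≤ M j.
  first-above-≤M : ∀ j → j ≤ n → ∀ b T → 1 ≤ b → b ≤ j → Linked (flip Adm) (b ∷ T) → (∀ y → Occurs y T → 1 ≤ y) →
    ∀ x B → filterᵇ (j <ᵇ_) T ≡ x ∷ B → x ≤ M j
  first-above-≤M j j≤n b []      _   _   _ _ x B ()
  first-above-≤M j j≤n b (a ∷ T) 1≤b b≤j (a≤Mb ∷ l) positive x B e with j <ᵇ a in j<a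
  ... | true with e
  ...   | refl = ≤-trans a≤Mb (M-mono b j 1≤b b≤j j≤n)
  first-above-≤M j j≤n b (a ∷ T) 1≤b b≤j (a≤Mb ∷ l) positive x B e | false =
    first-above-≤M j j≤n a T (positive a (occurs-head a T)) (≮⇒≥ (<ᵇ-false⇒≮ j a j<a)) l
      (λ y o → positive y (occurs-tail y a T o)) x B e

module Forward {n : ℕ} (τ : Permutation′ n) (k : Vec ℕ n) (k∈K : InK τ k) where
  open Interval τ

  -- Stage m: after inserting n, …, m+1 the reversed word F ++ [n+1] consists of
  -- the letters m+1, …, n+1 and is (flip Adm)-linked.
  Stage : ℕ → List ℕ → Set
  Stage m F = (F ++ [ suc n ]) ≋ range (suc m) (suc n ∸ m) × Linked (flip Adm) (F ++ [ suc n ])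

  k<w : ∀ m → m < n → kAt k (suc m) < w τ (suc m)
  k<w m m<n with toℕ-onto m m<n
  ... | f , refl = k∈K f

  stage-step : ∀ m → suc m ≤ n → ∀ F → Stage (suc m) F →
    Σ (List ℕ) (λ F′ → insertRev (inr (suc m)) (kAt k (suc m)) (suc m) (F ++ [ suc n ]) ≡ F′ ++ [ suc n ] × Stage m F′)
  stage-step m m<n F (letters , linked) = extend (insert-keeps-last (inr j) (kAt k j) j F (suc n) k<hits)
    where
    j : ℕ
    j = suc m
    R : List ℕ
    R = F ++ [ suc n ]
    R′ : List ℕ
    R′ = insertRev (inr j) (kAt k j) j R
    -- k_j < w_j = number of r_j-letters of R, all of them being in R
    k<hits : kAt k j < count (inr j) R
    k<hits = subst (kAt k j <_) (trans (w≡count-above j (s≤s z≤n) m<n) (sym (counts letters (inr j)))) (k<w m m<n)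
    letters′ : R′ ≋ range j (suc n ∸ m)
    letters′ = counts-agree λ p → begin
        count p R′                                           ≡⟨ count-insert (inr j) (kAt k j) j R p ⟩
        indicator (p j) + count p R                          ≡⟨ cong (indicator (p j) +_) (counts letters p) ⟩
        count p (range j (suc (suc n ∸ j)))                  ≡⟨ cong (λ c → count p (range j c)) (sym (+-∸-assoc 1 (≤-trans (n≤1+n m) m<n))) ⟩
        count p (range j (suc n ∸ m))                        ∎
      where open ≡-Reasoning
    -- every letter of R exceeds j, so j may precede it; the hits of r_j are ≤ M j
    linked′ : Linked (flip Adm) R′
    linked′ = linked-insert (inr j) (kAt k j) j R k<hits (λ x h → inr⇒≤M j x (s≤s z≤n) m<n h)
      (all-occurs R (λ y o → ≤-trans (<⇒≤ (proj₁ (≋-range-occurs letters o))) (m≤m+n y (w τ y)))) linked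
    extend : Σ (List ℕ) (λ F′ → R′ ≡ F′ ++ [ suc n ]) →
      Σ (List ℕ) (λ F′ → R′ ≡ F′ ++ [ suc n ] × Stage m F′)
    extend (F′ , eq) = F′ , eq , subst (_≋ range j (suc n ∸ m)) eq letters′ , subst (Linked (flip Adm)) eq linked′

  stages : ∀ m → m ≤ n → ∀ F → Stage m F →
    Σ (List ℕ) (λ F′ → stepsRev τ k m (F ++ [ suc n ]) ≡ F′ ++ [ suc n ] × Stage 0 F′)
  stages zero    _   F st = F , refl , st
  stages (suc m) m<n F st = subst (λ R → Σ (List ℕ) (λ F″ → stepsRev τ k m R ≡ F″ ++ [ suc n ] × Stage 0 F″))
      (sym (proj₁ (proj₂ next))) (stages m (≤-trans (n≤1+n m) m<n) (proj₁ next) (proj₂ (proj₂ next)))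
    where
    next : Σ (List ℕ) (λ F′ → insertRev (inr (suc m)) (kAt k (suc m)) (suc m) (F ++ [ suc n ]) ≡ F′ ++ [ suc n ] × Stage m F′)
    next = stage-step m m<n F st

  final : Σ (List ℕ) (λ F → stepsRev τ k n [ suc n ] ≡ F ++ [ suc n ] × Stage 0 F)
  final = stages n ≤-refl [] (counts-agree (λ p → cong (λ c → count p (range (suc n) c)) (sym (m+n∸n≡m 1 n))) , [-])

  F : List ℕ
  F = proj₁ final

  s : List ℕ
  s = reverse F

  finalWord≡ : finalWord τ k ≡ suc n ∷ s
  finalWord≡ = trans (steps≡stepsRev τ k n [ suc n ]) (trans (cong reverse (proj₁ (proj₂ final))) (ListP.reverse-++ F [ suc n ]))

  letters-s : s ≋ range 1 n
  letters-s = counts-agree λ p → trans (count-reverse p F)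
    (counts (≋-cancel-last F (range 1 n) (suc n) (subst ((F ++ [ suc n ]) ≋_) (range-snoc 1 n) (proj₁ (proj₂ (proj₂ final))))) p)

  σ : Permutation′ n
  σ = proj₁ (word⇒permutation s letters-s)

  linked-word : Linked Adm (suc n ∷ oneLine σ)
  linked-word = subst (λ z → Linked Adm (suc n ∷ z)) (sym (proj₁ (proj₂ (word⇒permutation s letters-s))))
    (subst (Linked Adm) (ListP.reverse-++ F [ suc n ]) (linked-reverse (F ++ [ suc n ]) (proj₂ (proj₂ (proj₂ final)))))

  image : Σ (Permutation′ n) (λ σ → Cond τ σ × Represents (beta τ k) (σ ⟨$⟩ˡ_))
  image = σ , linked⇒cond σ linked-word
            , beta-represents τ k s finalWord≡ letters-s (σ ⟨$⟩ˡ_) (proj₂ (proj₂ (word⇒permutation s letters-s)))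

-- Backward direction: for σ satisfying the condition, the vector of k_j =
-- (number of r_j-letters preceding j in the reversed final word) lies in K(τ)
-- and the construction rebuilds (n+1, σ).
module Backward {n : ℕ} (τ σ : Permutation′ n) (cond : Cond τ σ) where
  open Interval τ

  S : List ℕ
  S = reverse (suc n ∷ oneLine σ)

  S-linked : Linked (flip Adm) S
  S-linked = linked-reverse (suc n ∷ oneLine σ) (cond⇒linked σ cond)

  S-ends : S ≡ reverse (oneLine σ) ++ [ suc n ]
  S-ends = ListP.unfold-reverse (suc n) (oneLine σ)

  S-letters : S ≋ range 1 (suc n)
  S-letters = counts-agree λ p → begin
      count p S                                           ≡⟨ cong (count p) S-ends ⟩
      count p (reverse (oneLine σ) ++ [ suc n ])          ≡⟨ count-++ p (reverse (oneLine σ)) [ suc n ] ⟩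
      count p (reverse (oneLine σ)) + count p [ suc n ]   ≡⟨ cong (_+ count p [ suc n ]) (trans (count-reverse p (oneLine σ)) (counts (oneLine-≋ σ) p)) ⟩
      count p (range 1 n) + count p [ suc n ]             ≡⟨ sym (count-++ p (range 1 n) [ suc n ]) ⟩
      count p (range 1 n ++ [ suc n ])                    ≡⟨ cong (count p) (sym (range-snoc 1 n)) ⟩
      count p (range 1 (suc n))                           ∎
    where open ≡-Reasoning

  stage : ℕ → List ℕ
  stage m = filterᵇ (m <ᵇ_) S

  kval : ℕ → ℕ
  kval j = count (inr j) (before j S)

  module Letter (m : ℕ) (m<n : suc m ≤ n) where
    j : ℕ
    j = suc m

    A : List ℕ
    A = before j S

    T : List ℕ
    T = after j S

    j-occurs : Occurs j S
    j-occurs = ≋-range-member S-letters (s≤s z≤n) (s≤s (≤-trans m<n (n≤1+n n)))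

    S-split : S ≡ A ++ j ∷ T
    S-split = proj₁ (split-at j S j-occurs)

    j∉A : count (j ≡ᵇ_) A ≡ 0
    j∉A = proj₂ (split-at j S j-occurs)

    j∉T : count (j ≡ᵇ_) T ≡ 0
    j∉T = n≤0⇒n≡0 (≤-pred (subst (_≤ 1) count-in-S (≋-range-unique {x = j} S-letters)))
      where
      open ≡-Reasoning
      count-in-S : count (j ≡ᵇ_) S ≡ suc (count (j ≡ᵇ_) T)
      count-in-S = begin
        count (j ≡ᵇ_) S                            ≡⟨ cong (count (j ≡ᵇ_)) S-split ⟩
        count (j ≡ᵇ_) (A ++ j ∷ T)                 ≡⟨ count-++ (j ≡ᵇ_) A (j ∷ T) ⟩
        count (j ≡ᵇ_) A + count (j ≡ᵇ_) (j ∷ T)    ≡⟨ cong₂ _+_ j∉A (cong (λ b → indicator b + count (j ≡ᵇ_) T) (≡ᵇ-refl j)) ⟩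
        suc (count (j ≡ᵇ_) T)                      ∎

    T-in-S : ∀ {y} → Occurs y T → Occurs y S
    T-in-S {y} o = subst (Occurs y) (sym S-split) (occurs-++ʳ {y} A (j ∷ T) (occurs-tail y j T o))

    shift : ∀ xs → count (j ≡ᵇ_) xs ≡ 0 → filterᵇ (m <ᵇ_) xs ≡ filterᵇ (j <ᵇ_) xs
    shift xs absent = filterᵇ-cong-on (m <ᵇ_) (j <ᵇ_) xs (λ x o → <ᵇ-shift {m} {x} (occurs-absent {j} {x} {xs} absent o))

    stage-m : stage m ≡ filterᵇ (j <ᵇ_) A ++ j ∷ filterᵇ (j <ᵇ_) T
    stage-m = begin
        filterᵇ (m <ᵇ_) S                               ≡⟨ cong (filterᵇ (m <ᵇ_)) S-split ⟩
        filterᵇ (m <ᵇ_) (A ++ j ∷ T)                    ≡⟨ ListP.filter-++ (T? ∘ (m <ᵇ_)) A (j ∷ T) ⟩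
        filterᵇ (m <ᵇ_) A ++ filterᵇ (m <ᵇ_) (j ∷ T)    ≡⟨ cong (filterᵇ (m <ᵇ_) A ++_) (ListP.filter-accept (T? ∘ (m <ᵇ_)) {x = j} {xs = T} (<⇒<ᵇ (n<1+n m))) ⟩
        filterᵇ (m <ᵇ_) A ++ j ∷ filterᵇ (m <ᵇ_) T      ≡⟨ cong₂ (λ X Y → X ++ j ∷ Y) (shift A j∉A) (shift T j∉T) ⟩
        filterᵇ (j <ᵇ_) A ++ j ∷ filterᵇ (j <ᵇ_) T      ∎
      where open ≡-Reasoning

    stage-j : stage j ≡ filterᵇ (j <ᵇ_) A ++ filterᵇ (j <ᵇ_) T
    stage-j = trans (cong (filterᵇ (j <ᵇ_)) S-split) (trans (ListP.filter-++ (T? ∘ (j <ᵇ_)) A (j ∷ T))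
      (cong (filterᵇ (j <ᵇ_) A ++_) (ListP.filter-reject (T? ∘ (j <ᵇ_)) {x = j} {xs = T} (λ t → <-irrefl refl (<ᵇ⇒< j j t)))))

    -- S ends with n+1 ≠ j, so T contains n+1 and some letter of T exceeds j
    T-ends : Σ (List ℕ) (λ T′ → T ≡ T′ ++ [ suc n ])
    T-ends = split-last A j T (reverse (oneLine σ)) (suc n) (trans (sym S-split) S-ends) (λ e → <-irrefl e (s≤s m<n))

    top-kept : ∀ T′ → filterᵇ (j <ᵇ_) (T′ ++ [ suc n ]) ≢ []
    top-kept T′ e with trans (sym (ListP.filter-accept (T? ∘ (j <ᵇ_)) {x = suc n} {xs = []} (<⇒<ᵇ (s≤s m<n))))
                             (ListP.++-conicalʳ (filterᵇ (j <ᵇ_) T′) (filterᵇ (j <ᵇ_) [ suc n ]) (trans (sym (ListP.filter-++ (T? ∘ (j <ᵇ_)) T′ [ suc n ])) e))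
    ... | ()

    first : Σ ℕ (λ x → Σ (List ℕ) (λ B → filterᵇ (j <ᵇ_) T ≡ x ∷ B))
    first with filterᵇ (j <ᵇ_) T in e
    ... | x ∷ B = x , B , refl
    ... | []    = ⊥-elim (top-kept (proj₁ T-ends) (trans (cong (filterᵇ (j <ᵇ_)) (sym (proj₂ T-ends))) e))

    next : ℕ
    next = proj₁ first

    rest : List ℕ
    rest = proj₁ (proj₂ first)

    T-above : filterᵇ (j <ᵇ_) T ≡ next ∷ rest
    T-above = proj₂ (proj₂ first)

    -- by linkedness next ≤ M j, hence next ∈ r_j
    next-in-r : inr j next ≡ true
    next-in-r = ≤M⇒inr j next (s≤s z≤n) m<n (<ᵇ-true⇒< j next (proj₁ head)) next≤Mj
                  (≤-pred (proj₂ (≋-range-occurs {x = next} S-letters (T-in-S {next} (proj₂ head)))))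
      where
      head : (j <ᵇ next) ≡ true × Occurs next T
      head = filterᵇ-head (j <ᵇ_) T next rest T-above
      next≤Mj : next ≤ M j
      next≤Mj = first-above-≤M j m<n j T (s≤s z≤n) ≤-refl
        (linked-suffix A (j ∷ T) (subst (Linked (flip Adm)) S-split S-linked))
        (λ y o → proj₁ (≋-range-occurs {x = y} S-letters (T-in-S {y} o))) next rest T-above

    kval≡ : kval j ≡ count (inr j) (filterᵇ (j <ᵇ_) A)
    kval≡ = sym (count-inr-above j (s≤s z≤n) m<n A)

    insertion : insertRev (inr (suc m)) (kval (suc m)) (suc m) (stage (suc m)) ≡ stage m
    insertion = begin
        insertRev (inr j) (kval j) j (stage j)
      ≡⟨ cong₂ (λ c R → insertRev (inr j) c j R) kval≡ (trans stage-j (cong (filterᵇ (j <ᵇ_) A ++_) T-above)) ⟩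
        insertRev (inr j) (count (inr j) (filterᵇ (j <ᵇ_) A)) j (filterᵇ (j <ᵇ_) A ++ next ∷ rest)
      ≡⟨ insert-at (inr j) (filterᵇ (j <ᵇ_) A) j next rest next-in-r ⟩
        filterᵇ (j <ᵇ_) A ++ j ∷ next ∷ rest
      ≡⟨ sym (trans stage-m (cong (λ z → filterᵇ (j <ᵇ_) A ++ j ∷ z) T-above)) ⟩
        stage m
      ∎
      where open ≡-Reasoning

    -- w_j counts the r_j-letters before j plus those after it, among them next
    kval<w : kval (suc m) < w τ (suc m)
    kval<w = subst (kval j <_) (sym w≡) (m<m+n (kval j) (s≤s z≤n))
      where
      open ≡-Reasoning
      j∉r : inr j j ≡ false
      j∉r with inr j j in e
      ... | true  = ⊥-elim (<-irrefl refl (inr⇒> j j (s≤s z≤n) m<n e))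
      ... | false = refl
      w≡ : w τ j ≡ kval j + suc (count (inr j) rest)
      w≡ = begin
          w τ j                                                  ≡⟨ w≡count j ⟩
          count (inr j) (range 1 (suc n))                        ≡⟨ sym (counts S-letters (inr j)) ⟩
          count (inr j) S                                        ≡⟨ cong (count (inr j)) S-split ⟩
          count (inr j) (A ++ j ∷ T)                             ≡⟨ count-++ (inr j) A (j ∷ T) ⟩
          kval j + (indicator (inr j j) + count (inr j) T)       ≡⟨ cong (λ b → kval j + (indicator b + count (inr j) T)) j∉r ⟩
          kval j + count (inr j) T                               ≡⟨ cong (kval j +_) (sym (count-inr-above j (s≤s z≤n) m<n T)) ⟩
          kval j + count (inr j) (filterᵇ (j <ᵇ_) T)             ≡⟨ cong (λ z → kval j + count (inr j) z) T-above ⟩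
          kval j + (indicator (inr j next) + count (inr j) rest) ≡⟨ cong (λ b → kval j + (indicator b + count (inr j) rest)) next-in-r ⟩
          kval j + suc (count (inr j) rest)                      ∎

  kσ : Vec ℕ n
  kσ = Vec.tabulate (λ i → kval (suc (toℕ i)))

  kAt-kσ : ∀ m → m < n → kAt kσ (suc m) ≡ kval (suc m)
  kAt-kσ m m<n with toℕ-onto m m<n
  ... | f , refl = nth-vecTabulate (λ i → kval (suc (toℕ i))) f

  kσ∈K : InK τ kσ
  kσ∈K i = subst (_< w τ (suc (toℕ i))) (sym (nth-vecTabulate (λ i → kval (suc (toℕ i))) i))
             (Letter.kval<w (toℕ i) (FinP.toℕ<n i))

  rebuild : ∀ m → m ≤ n → stepsRev τ kσ m (stage m) ≡ S
  rebuild zero    _   = filterᵇ-all (0 <ᵇ_) S (λ y o → <⇒<ᵇ-true (proj₁ (≋-range-occurs {x = y} S-letters o)))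
  rebuild (suc m) m<n rewrite kAt-kσ m m<n | Letter.insertion m m<n = rebuild m (≤-trans (n≤1+n m) m<n)

  stage-n : stage n ≡ [ suc n ]
  stage-n = trans (cong (filterᵇ (n <ᵇ_)) S-ends) (trans (ListP.filter-++ (T? ∘ (n <ᵇ_)) (reverse (oneLine σ)) [ suc n ])
    (cong₂ _++_ (filterᵇ-none (n <ᵇ_) (reverse (oneLine σ)) small) (ListP.filter-accept (T? ∘ (n <ᵇ_)) {x = suc n} {xs = []} (<⇒<ᵇ (n<1+n n)))))
    where
    small : ∀ y → Occurs y (reverse (oneLine σ)) → (n <ᵇ y) ≡ false
    small y o = ≮⇒<ᵇ-false (λ n<y → <⇒≱ n<y (≤-pred (proj₂ (≋-range-occurs {x = y} (oneLine-≋ σ)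
                  (subst (1 ≤_) (count-reverse (y ≡ᵇ_) (oneLine σ)) o)))))

  finalWord≡ : finalWord τ kσ ≡ suc n ∷ oneLine σ
  finalWord≡ = begin
      finalWord τ kσ                          ≡⟨ steps≡stepsRev τ kσ n [ suc n ] ⟩
      reverse (stepsRev τ kσ n [ suc n ])     ≡⟨ cong (λ R → reverse (stepsRev τ kσ n R)) (sym stage-n) ⟩
      reverse (stepsRev τ kσ n (stage n))     ≡⟨ cong reverse (rebuild n ≤-refl) ⟩
      reverse S                               ≡⟨ ListP.reverse-involutive (suc n ∷ oneLine σ) ⟩
      suc n ∷ oneLine σ                       ∎
    where open ≡-Reasoning

  preimage : Σ (Vec ℕ n) (λ k → InK τ k × Represents (beta τ k) (σ ⟨$⟩ˡ_))
  preimage = kσ , kσ∈K , beta-represents τ kσ (oneLine σ) finalWord≡ (oneLine-≋ σ) (σ ⟨$⟩ˡ_) hits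
    where
    hits : ∀ j → nth (oneLine σ) (toℕ (σ ⟨$⟩ˡ j)) ≡ suc (toℕ j)
    hits j = trans (nth-oneLine σ (σ ⟨$⟩ˡ j)) (cong (λ f → suc (toℕ f)) (inverseʳ σ))

-- Proposition 3.8
proposition3p8 : (n : ℕ) → 1 ≤ n → (τ : Permutation′ n) →
    ((k : Vec ℕ n) → InK τ k →
      Σ (Permutation′ n) (λ σ → Cond τ σ × Represents (beta τ k) (σ ⟨$⟩ˡ_)))
    × ((σ : Permutation′ n) → Cond τ σ →
      Σ (Vec ℕ n) (λ k → InK τ k × Represents (beta τ k) (σ ⟨$⟩ˡ_)))
proposition3p8 n _ τ = (λ k k∈K → Forward.image τ k k∈K) , (λ σ cond → Backward.preimage τ σ cond)
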